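{- Let $f$ be an AC symbol that is nilpotent ($f(x,x)=e$ for a fixed constant $e$), and let $R_S$ be a finite set of rewrite rules between $f$-monomials over a finite set $C$ of constants (with $e\in C$) such that no $f$-monomial occurring in a rule of $R_S$ contains a repeated constant. Let $\rightarrow$ be the union of $\rightarrow_{R_S}$ with the nilpotency rewriting $f(M)\rightarrow f((M-\{\!\{a,a\}\!\})\cup\{\!\{e\}\!\})$ (for any constant $a$ occurring at least twice in $M$). Then $\rightarrow$ is locally confluent if and only if (i) for every pair of distinct rules $f(A_1)\rightarrow f(A_2)$, $f(B_1)\rightarrow f(B_2)$ in $R_S$, the critical pair $(f((AB-A_1)\cup A_2), f((AB-B_1)\cup B_2))$ with $AB=(A_1\cup B_1)-(A_1\cap B_1)$ is joinable, and (ii) for every rule $f(M)\rightarrow f(N)\in R_S$ and every constant $a\in M$, the pair $(f(N\cup\{\!\{a\}\!\}), f((M-\{\!\{a\}\!\})\cup\{\!\{e\}\!\}))$ is joinable; joinability being with respect to $\rightarrow$.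
   Context: $f$-monomials: $f(M)$ with $M$ a nonempty finite multiset of constants; a constant $c$ is identified with $f(\{\!\{c\}\!\})$. On multisets $\cup$ is multiset sum, $\cap$ multiset intersection (min of multiplicities), $-$ truncated multiset difference, $\subseteq$ sub-multiset. A rule $f(A)\rightarrow f(B)$ rewrites $f(M)$ to $f((M-A)\cup B)$ when $A\subseteq M$. A relation is locally confluent if any two one-step reducts of a term have a common reduct; a pair is joinable if both components reduce (in zero or more steps) to a common term. -}

module Defs where

open import Data.Nat using (ℕ; _+_; _∸_; _⊓_; _≤_)
open import Data.Fin using (Fin)
open import Data.Vec using (Vec; lookup; zipWith; replicate; _[_]≔_)
open import Data.Product using (_×_; ∃; ∃-syntax; _,_)
open import Data.Sum using (_⊎_)
open import Data.List using (List)
open import Data.List.Membership.Propositional using (_∈_)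
open import Relation.Binary.PropositionalEquality using (_≡_; _≢_)
open import Relation.Binary.Construct.Closure.ReflexiveTransitive using (Star)

-- The finite set of constants C is Fin n.  A finite multiset over C is
-- represented by its vector of multiplicities.
MSet : ℕ → Set
MSet n = Vec ℕ n

module _ {n : ℕ} where

  _∪_ : MSet n → MSet n → MSet n
  _∪_ = zipWith _+_

  _∩_ : MSet n → MSet n → MSet n
  _∩_ = zipWith _⊓_

  _-_ : MSet n → MSet n → MSet n
  _-_ = zipWith _∸_

  _⊆_ : MSet n → MSet n → Set
  A ⊆ B = ∀ i → lookup A i ≤ lookup B i

  _∈ₘ_ : Fin n → MSet n → Set
  a ∈ₘ M = 1 ≤ lookup M a

  sing : Fin n → MSet n
  sing a = replicate n 0 [ a ]≔ 1

  pair : Fin n → Fin n → MSet n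
  pair a b = sing a ∪ sing b

  Nonempty : MSet n → Set
  Nonempty M = ∃[ i ] (i ∈ₘ M)

  RepetitionFree : MSet n → Set
  RepetitionFree M = ∀ i → lookup M i ≤ 1

Rule : ℕ → Set
Rule n = MSet n × MSet n

module _ {n : ℕ} where

  WellFormedRule : Rule n → Set
  WellFormedRule (A , B) =
    Nonempty A × Nonempty B × RepetitionFree A × RepetitionFree B

  RuleStep : List (Rule n) → MSet n → MSet n → Set
  RuleStep R M M' = ∃[ A ] ∃[ B ] ((A , B) ∈ R × A ⊆ M × M' ≡ (M - A) ∪ B)

  NilStep : Fin n → MSet n → MSet n → Set
  NilStep e M M' = ∃[ a ] (2 ≤ lookup M a × M' ≡ (M - pair a a) ∪ sing e)

  Step : Fin n → List (Rule n) → MSet n → MSet n → Set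
  Step e R M M' = RuleStep R M M' ⊎ NilStep e M M'

  Joinable : (MSet n → MSet n → Set) → MSet n → MSet n → Set
  Joinable _⟶_ s t = ∃[ u ] (Star _⟶_ s u × Star _⟶_ t u)

  LocallyConfluent : (MSet n → MSet n → Set) → Set
  LocallyConfluent _⟶_ = ∀ M → Nonempty M → ∀ s t →
    M ⟶ s → M ⟶ t → Joinable _⟶_ s t

  CondI : Fin n → List (Rule n) → Set
  CondI e R = ∀ A₁ A₂ B₁ B₂ → (A₁ , A₂) ∈ R → (B₁ , B₂) ∈ R →
    (A₁ , A₂) ≢ (B₁ , B₂) →
    let AB = (A₁ ∪ B₁) - (A₁ ∩ B₁) in
    Joinable (Step e R) ((AB - A₁) ∪ A₂) ((AB - B₁) ∪ B₂)

  CondII : Fin n → List (Rule n) → Set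
  CondII e R = ∀ M N → (M , N) ∈ R → ∀ a → a ∈ₘ M →
    Joinable (Step e R) (N ∪ sing a) ((M - sing a) ∪ sing e)

-- For two rules, the peak at M is the critical peak at the join AB of their
-- left-hand sides (the pointwise maximum, hence contained in M), shifted by the
-- context M - AB: rewriting is stable under adding context.  A nilpotency redex
-- {{a,a}} either fits beside the other redex, and the two steps commute, or a
-- occurs in the other left-hand side A, exactly once by repetition-freeness, and the
-- peak is the one of condition (ii) at A ∪ {{a}}, shifted likewise.  Conversely
-- each critical pair is itself a peak of ⟶, at AB or at A ∪ {{a}}.
module Submission where

open import Defs
open import Data.Fin using (Fin)
open import Data.Fin.Properties using () renaming (_≟_ to _≟ᶠ_)
open import Data.List using (List)
open import Data.List.Membership.Propositional using (_∈_)
open import Data.Nat using (ℕ; suc; _+_; _∸_; _⊓_; _⊔_; _≤_; z≤n; s≤s)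
open import Data.Nat.Properties
open import Algebra.Properties.CommutativeSemigroup +-commutativeSemigroup
  using (xy∙z≈xz∙y)
open import Data.Product using (_×_; _,_; proj₁; proj₂)
open import Data.Product.Properties using () renaming (≡-dec to ×-≡-dec)
open import Data.Sum using (inj₁; inj₂)
open import Data.Vec using (lookup; tabulate; replicate)
open import Data.Vec.Properties
  using (lookup-zipWith; lookup∘update; lookup∘update′; lookup-replicate;
         zipWith-comm; tabulate∘lookup; tabulate-cong)
  renaming (≡-dec to vec-≡-dec)
open import Function.Base using (_∘_)
open import Function.Bundles using (_⇔_; mk⇔)
open import Relation.Binary.Construct.Closure.ReflexiveTransitive using (ε; _◅_; gmap)
open import Relation.Binary.PropositionalEquality
open import Relation.Nullary using (yes; no)
open ≡-Reasoning

[m∸n+o]+p≡[m+p∸n]+o : ∀ {m n} o p → n ≤ m → (m ∸ n + o) + p ≡ (m + p ∸ n) + o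
[m∸n+o]+p≡[m+p∸n]+o {m} {n} o p n≤m = begin
  (m ∸ n + o) + p  ≡⟨ xy∙z≈xz∙y (m ∸ n) o p ⟩
  (m ∸ n + p) + o  ≡⟨ cong (_+ o) (+-∸-comm p n≤m) ⟨
  (m + p ∸ n) + o  ∎

[[m∸a+b]∸c]+d≡[[m∸c+d]∸a]+b : ∀ {m a c} b d → a + c ≤ m →
  ((m ∸ a + b) ∸ c) + d ≡ ((m ∸ c + d) ∸ a) + b
[[m∸a+b]∸c]+d≡[[m∸c+d]∸a]+b {m} {a} {c} b d a+c≤m = begin
  ((m ∸ a + b) ∸ c) + d  ≡⟨ cong (_+ d) (+-∸-comm b (m+n≤o⇒m≤o∸n c c+a≤m)) ⟩
  ((m ∸ a ∸ c) + b) + d  ≡⟨ xy∙z≈xz∙y (m ∸ a ∸ c) b d ⟩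
  ((m ∸ a ∸ c) + d) + b  ≡⟨ cong (λ k → (k + d) + b) m∸a∸c≡m∸c∸a ⟩
  ((m ∸ c ∸ a) + d) + b  ≡⟨ cong (_+ b) (+-∸-comm d (m+n≤o⇒m≤o∸n a a+c≤m)) ⟨
  ((m ∸ c + d) ∸ a) + b  ∎
  where
  c+a≤m : c + a ≤ m
  c+a≤m = subst (_≤ m) (+-comm a c) a+c≤m
  m∸a∸c≡m∸c∸a : m ∸ a ∸ c ≡ m ∸ c ∸ a
  m∸a∸c≡m∸c∸a = begin
    m ∸ a ∸ c    ≡⟨ ∸-+-assoc m a c ⟩
    m ∸ (a + c)  ≡⟨ cong (m ∸_) (+-comm a c) ⟩
    m ∸ (c + a)  ≡⟨ ∸-+-assoc m c a ⟨
    m ∸ c ∸ a    ∎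

[m+n]∸[n+n]≡m∸n : ∀ m n → (m + n) ∸ (n + n) ≡ m ∸ n
[m+n]∸[n+n]≡m∸n m n = begin
  (m + n) ∸ (n + n)  ≡⟨ ∸-+-assoc (m + n) n n ⟨
  (m + n) ∸ n ∸ n    ≡⟨ cong (_∸ n) (m+n∸n≡m m n) ⟩
  m ∸ n              ∎

[m+n]∸[m⊓n]≡m⊔n : ∀ m n → (m + n) ∸ (m ⊓ n) ≡ m ⊔ n
[m+n]∸[m⊓n]≡m⊔n m n with ≤-total m n
... | inj₁ m≤n rewrite m≤n⇒m⊓n≡m m≤n | m≤n⇒m⊔n≡n m≤n = m+n∸m≡n m n
... | inj₂ n≤m rewrite m≥n⇒m⊓n≡n n≤m | m≥n⇒m⊔n≡m n≤m = m+n∸n≡m m n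

private
  variable
    n : ℕ
    a b : Fin n
    A B C D M P X Y A₁ A₂ B₁ B₂ : MSet n

join : MSet n → MSet n → MSet n
join A B = (A ∪ B) - (A ∩ B)

lookup-≗⇒≡ : (∀ i → lookup X i ≡ lookup M i) → X ≡ M
lookup-≗⇒≡ {X = X} {M = M} X≗M = begin
  X                   ≡⟨ tabulate∘lookup X ⟨
  tabulate (lookup X)  ≡⟨ tabulate-cong X≗M ⟩
  tabulate (lookup M)  ≡⟨ tabulate∘lookup M ⟩
  M                   ∎

lookup-∪ : ∀ (X Y : MSet n) i → lookup (X ∪ Y) i ≡ lookup X i + lookup Y i
lookup-∪ X Y i = lookup-zipWith _+_ i X Y

lookup-- : ∀ (X Y : MSet n) i → lookup (X - Y) i ≡ lookup X i ∸ lookup Y i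
lookup-- X Y i = lookup-zipWith _∸_ i X Y

lookup-[-]∪ : ∀ (X A B : MSet n) i →
  lookup ((X - A) ∪ B) i ≡ lookup X i ∸ lookup A i + lookup B i
lookup-[-]∪ X A B i = trans (lookup-∪ (X - A) B i) (cong (_+ _) (lookup-- X A i))

lookup-join : ∀ (A B : MSet n) i → lookup (join A B) i ≡ lookup A i ⊔ lookup B i
lookup-join A B i
  rewrite lookup-- (A ∪ B) (A ∩ B) i | lookup-∪ A B i | lookup-zipWith _⊓_ i A B
  = [m+n]∸[m⊓n]≡m⊔n (lookup A i) (lookup B i)

lookup-sing-≡ : ∀ (a : Fin n) → lookup (sing a) a ≡ 1
lookup-sing-≡ {n} a = lookup∘update a (replicate n 0) 1

lookup-sing-≢ : ∀ {i} → i ≢ a → lookup (sing a) i ≡ 0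
lookup-sing-≢ {n} {i = i} i≢a =
  trans (lookup∘update′ i≢a (replicate n 0) 1) (lookup-replicate i 0)

lookup-pair-≡ : ∀ (a : Fin n) → lookup (pair a a) a ≡ 2
lookup-pair-≡ a =
  trans (lookup-∪ (sing a) (sing a) a) (cong₂ _+_ (lookup-sing-≡ a) (lookup-sing-≡ a))

lookup-pair-≢ : ∀ {i} → i ≢ a → lookup (pair a a) i ≡ 0
lookup-pair-≢ {a = a} {i} i≢a =
  trans (lookup-∪ (sing a) (sing a) i) (cong₂ _+_ (lookup-sing-≢ i≢a) (lookup-sing-≢ i≢a))

∪-comm : ∀ (X Y : MSet n) → X ∪ Y ≡ Y ∪ X
∪-comm = zipWith-comm +-comm

X⊆X∪Y : ∀ (X Y : MSet n) → X ⊆ (X ∪ Y)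
X⊆X∪Y X Y i = subst (lookup X i ≤_) (sym (lookup-∪ X Y i)) (m≤m+n _ _)

⊆-trans : A ⊆ B → B ⊆ C → A ⊆ C
⊆-trans A⊆B B⊆C i = ≤-trans (A⊆B i) (B⊆C i)

[X∪Y]-X≡Y : ∀ (X Y : MSet n) → (X ∪ Y) - X ≡ Y
[X∪Y]-X≡Y X Y = lookup-≗⇒≡ λ i → begin
  lookup ((X ∪ Y) - X) i               ≡⟨ lookup-- (X ∪ Y) X i ⟩
  lookup (X ∪ Y) i ∸ lookup X i         ≡⟨ cong (_∸ lookup X i) (lookup-∪ X Y i) ⟩
  lookup X i + lookup Y i ∸ lookup X i  ≡⟨ m+n∸m≡n (lookup X i) (lookup Y i) ⟩
  lookup Y i                           ∎

[X∪Y]-X∪Z≡Z∪Y : ∀ (X Y Z : MSet n) → ((X ∪ Y) - X) ∪ Z ≡ Z ∪ Y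
[X∪Y]-X∪Z≡Z∪Y X Y Z = trans (cong (_∪ Z) ([X∪Y]-X≡Y X Y)) (∪-comm Y Z)

[X∪Y]-[Y∪Y]≡X-Y : ∀ (X Y : MSet n) → (X ∪ Y) - (Y ∪ Y) ≡ X - Y
[X∪Y]-[Y∪Y]≡X-Y X Y = lookup-≗⇒≡ λ i →
  let x = lookup X i; y = lookup Y i in
  begin
    lookup ((X ∪ Y) - (Y ∪ Y)) i         ≡⟨ lookup-- (X ∪ Y) (Y ∪ Y) i ⟩
    lookup (X ∪ Y) i ∸ lookup (Y ∪ Y) i  ≡⟨ cong₂ _∸_ (lookup-∪ X Y i) (lookup-∪ Y Y i) ⟩
    (x + y) ∸ (y + y)                    ≡⟨ [m+n]∸[n+n]≡m∸n x y ⟩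
    x ∸ y                                ≡⟨ lookup-- X Y i ⟨
    lookup (X - Y) i                     ∎

X∪[M-X]≡M : X ⊆ M → X ∪ (M - X) ≡ M
X∪[M-X]≡M {X = X} {M = M} X⊆M = lookup-≗⇒≡ λ i →
  trans (lookup-∪ X (M - X) i) (trans (cong (_ +_) (lookup-- M X i)) (m+[n∸m]≡n (X⊆M i)))

[P-A∪B]∪K≡[P∪K-A]∪B : ∀ B K → A ⊆ P → ((P - A) ∪ B) ∪ K ≡ ((P ∪ K) - A) ∪ B
[P-A∪B]∪K≡[P∪K-A]∪B {A = A} {P = P} B K A⊆P = lookup-≗⇒≡ λ i →
  begin
    lookup (((P - A) ∪ B) ∪ K) i
      ≡⟨ trans (lookup-∪ ((P - A) ∪ B) K i) (cong (_+ lookup K i) (lookup-[-]∪ P A B i)) ⟩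
    (lookup P i ∸ lookup A i + lookup B i) + lookup K i
      ≡⟨ [m∸n+o]+p≡[m+p∸n]+o (lookup B i) (lookup K i) (A⊆P i) ⟩
    (lookup P i + lookup K i ∸ lookup A i) + lookup B i
      ≡⟨ cong (λ k → k ∸ lookup A i + lookup B i) (lookup-∪ P K i) ⟨
    lookup (P ∪ K) i ∸ lookup A i + lookup B i  ≡⟨ lookup-[-]∪ (P ∪ K) A B i ⟨
    lookup (((P ∪ K) - A) ∪ B) i  ∎

[[M-A∪B]-C]∪D≡[[M-C∪D]-A]∪B : ∀ B D → (A ∪ C) ⊆ M →
  (((M - A) ∪ B) - C) ∪ D ≡ (((M - C) ∪ D) - A) ∪ B
[[M-A∪B]-C]∪D≡[[M-C∪D]-A]∪B {A = A} {C = C} {M = M} B D A∪C⊆M = lookup-≗⇒≡ λ i →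
  let m = lookup M i; a = lookup A i; b = lookup B i; c = lookup C i; d = lookup D i in
  begin
    lookup ((((M - A) ∪ B) - C) ∪ D) i  ≡⟨ lookup-[-]∪ ((M - A) ∪ B) C D i ⟩
    lookup ((M - A) ∪ B) i ∸ c + d      ≡⟨ cong (λ k → k ∸ c + d) (lookup-[-]∪ M A B i) ⟩
    ((m ∸ a + b) ∸ c) + d               ≡⟨ [[m∸a+b]∸c]+d≡[[m∸c+d]∸a]+b {m} {a} {c} b d
                                             (subst (_≤ m) (lookup-∪ A C i) (A∪C⊆M i)) ⟩
    ((m ∸ c + d) ∸ a) + b               ≡⟨ cong (λ k → k ∸ a + b) (lookup-[-]∪ M C D i) ⟨
    lookup ((M - C) ∪ D) i ∸ a + b      ≡⟨ lookup-[-]∪ ((M - C) ∪ D) A B i ⟨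
    lookup ((((M - C) ∪ D) - A) ∪ B) i  ∎

X∪Y⊆M⇒Y⊆[M-X]∪Z : ∀ Z → (X ∪ Y) ⊆ M → Y ⊆ ((M - X) ∪ Z)
X∪Y⊆M⇒Y⊆[M-X]∪Z {X = X} {Y = Y} {M = M} Z X∪Y⊆M i =
  let m = lookup M i; x = lookup X i; y = lookup Y i; z = lookup Z i in
  subst (y ≤_) (sym (lookup-[-]∪ M X Z i))
    (≤-trans (m+n≤o⇒m≤o∸n y (subst (_≤ m) (trans (lookup-∪ X Y i) (+-comm x y)) (X∪Y⊆M i)))
             (m≤m+n (m ∸ x) z))

⊆-joinˡ : ∀ (A B : MSet n) → A ⊆ join A B
⊆-joinˡ A B i = subst (lookup A i ≤_) (sym (lookup-join A B i)) (m≤m⊔n (lookup A i) (lookup B i))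

⊆-joinʳ : ∀ (A B : MSet n) → B ⊆ join A B
⊆-joinʳ A B i = subst (lookup B i ≤_) (sym (lookup-join A B i)) (m≤n⊔m (lookup A i) (lookup B i))

join-lub : A ⊆ M → B ⊆ M → join A B ⊆ M
join-lub {A = A} {M = M} {B = B} A⊆M B⊆M i =
  subst (_≤ lookup M i) (sym (lookup-join A B i)) (⊔-lub (A⊆M i) (B⊆M i))

⊆-nonempty : A ⊆ B → Nonempty A → Nonempty B
⊆-nonempty A⊆B (i , i∈A) = i , ≤-trans i∈A (A⊆B i)

∪-⊆-at : ∀ (a : Fin n) → C ⊆ M → (∀ {i} → i ≢ a → lookup D i ≡ 0) →
  lookup C a + lookup D a ≤ lookup M a → (C ∪ D) ⊆ M
∪-⊆-at {C = C} {M = M} {D = D} a C⊆M D-off-a C+D≤M i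
  rewrite lookup-∪ C D i with i ≟ᶠ a
... | yes refl = C+D≤M
... | no i≢a rewrite D-off-a i≢a | +-identityʳ (lookup C i) = C⊆M i

2≤⇒pair⊆ : ∀ (a : Fin n) → 2 ≤ lookup M a → pair a a ⊆ M
2≤⇒pair⊆ a 2≤M i with i ≟ᶠ a
... | yes refl rewrite lookup-pair-≡ a = 2≤M
... | no i≢a rewrite lookup-pair-≢ i≢a = z≤n

pair⊆⇒2≤ : ∀ (a : Fin n) → pair a a ⊆ M → 2 ≤ lookup M a
pair⊆⇒2≤ {M = M} a pair⊆M = subst (_≤ lookup M a) (lookup-pair-≡ a) (pair⊆M a)

pair⊆X∪sing : ∀ (a : Fin n) → lookup X a ≡ 1 → pair a a ⊆ (X ∪ sing a)
pair⊆X∪sing {X = X} a Xa≡1 = 2≤⇒pair⊆ {M = X ∪ sing a} a (subst (2 ≤_) 1+1≡[X∪sing]a ≤-refl)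
  where
  1+1≡[X∪sing]a : 1 + 1 ≡ lookup (X ∪ sing a) a
  1+1≡[X∪sing]a = sym (trans (lookup-∪ X (sing a) a) (cong₂ _+_ Xa≡1 (lookup-sing-≡ a)))

module LocalConfluence {n : ℕ} (e : Fin n) (R : List (Rule n)) where

  _⟶_ : MSet n → MSet n → Set
  _⟶_ = Step e R

  _↓_ : MSet n → MSet n → Set
  _↓_ = Joinable _⟶_

  ↓-refl : M ↓ M
  ↓-refl = _ , ε , ε

  ↓-sym : M ↓ P → P ↓ M
  ↓-sym (S , M⟶*S , P⟶*S) = S , P⟶*S , M⟶*S

  Rewrites : MSet n → MSet n → Set
  Rewrites A B = ∀ M → A ⊆ M → M ⟶ ((M - A) ∪ B)

  rule-rewrites : (A , B) ∈ R → Rewrites A B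
  rule-rewrites A,B∈R _ A⊆M = inj₁ (_ , _ , A,B∈R , A⊆M , refl)

  nil-rewrites : ∀ a → Rewrites (pair a a) (sing e)
  nil-rewrites a M pair⊆M = inj₂ (a , pair⊆⇒2≤ {M = M} a pair⊆M , refl)

  rewrites-∪ : Rewrites A B → A ⊆ P → ∀ K → (P ∪ K) ⟶ (((P - A) ∪ B) ∪ K)
  rewrites-∪ {A = A} {B = B} {P = P} A→B A⊆P K =
    subst ((P ∪ K) ⟶_) (sym ([P-A∪B]∪K≡[P∪K-A]∪B {A = A} B K A⊆P))
      (A→B (P ∪ K) (⊆-trans {A = A} {B = P} {C = P ∪ K} A⊆P (X⊆X∪Y P K)))

  ⟶-∪ : ∀ K → P ⟶ X → (P ∪ K) ⟶ (X ∪ K)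
  ⟶-∪ K (inj₁ (A , B , A,B∈R , A⊆P , refl)) = rewrites-∪ (rule-rewrites A,B∈R) A⊆P K
  ⟶-∪ {P = P} K (inj₂ (a , 2≤Pa , refl)) =
    rewrites-∪ (nil-rewrites a) (2≤⇒pair⊆ {M = P} a 2≤Pa) K

  ↓-∪ : ∀ K → P ↓ X → (P ∪ K) ↓ (X ∪ K)
  ↓-∪ K (S , P⟶*S , X⟶*S) = S ∪ K , gmap (_∪ K) (⟶-∪ K) P⟶*S , gmap (_∪ K) (⟶-∪ K) X⟶*S

  ↓-in-context : X ⊆ M → A ⊆ X → C ⊆ X →
    ((X - A) ∪ B) ↓ ((X - C) ∪ D) → ((M - A) ∪ B) ↓ ((M - C) ∪ D)
  ↓-in-context {X = X} {M = M} {B = B} {D = D} X⊆M A⊆X C⊆X =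
    subst₂ _↓_ (reduct-in-context B A⊆X) (reduct-in-context D C⊆X) ∘ ↓-∪ (M - X)
    where
    reduct-in-context : ∀ {A} B → A ⊆ X → ((X - A) ∪ B) ∪ (M - X) ≡ (M - A) ∪ B
    reduct-in-context {A} B A⊆X = begin
      ((X - A) ∪ B) ∪ (M - X)  ≡⟨ [P-A∪B]∪K≡[P∪K-A]∪B {A = A} B (M - X) A⊆X ⟩
      ((X ∪ (M - X)) - A) ∪ B  ≡⟨ cong (λ Y → (Y - A) ∪ B) (X∪[M-X]≡M X⊆M) ⟩
      (M - A) ∪ B              ∎

  independent-↓ : Rewrites A B → Rewrites C D → (A ∪ C) ⊆ M →
    ((M - A) ∪ B) ↓ ((M - C) ∪ D)
  independent-↓ {A = A} {B = B} {C = C} {D = D} {M = M} A→B C→D A∪C⊆M =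
    _ , C→D ((M - A) ∪ B) (X∪Y⊆M⇒Y⊆[M-X]∪Z {X = A} {Y = C} {M = M} B A∪C⊆M) ◅ ε
      , subst (((M - C) ∪ D) ⟶_)
              (sym ([[M-A∪B]-C]∪D≡[[M-C∪D]-A]∪B {A = A} {C = C} {M = M} B D A∪C⊆M))
              (A→B ((M - C) ∪ D) (X∪Y⊆M⇒Y⊆[M-X]∪Z {X = C} {Y = A} {M = M} D C∪A⊆M)) ◅ ε
    where
    C∪A⊆M : (C ∪ A) ⊆ M
    C∪A⊆M = subst (_⊆ M) (∪-comm A C) A∪C⊆M

  WellFormed : Set
  WellFormed = ∀ {r} → r ∈ R → WellFormedRule r

  lhs-repetitionFree : WellFormed → (A , B) ∈ R → RepetitionFree A
  lhs-repetitionFree wf A,B∈R = proj₁ (proj₂ (proj₂ (wf A,B∈R)))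

  locallyConfluent⇒condI : WellFormed → LocallyConfluent _⟶_ → CondI e R
  locallyConfluent⇒condI wf lc A₁ A₂ B₁ B₂ A∈R B∈R _ =
    lc (join A₁ B₁) (⊆-nonempty {A = A₁} {B = join A₁ B₁} (⊆-joinˡ A₁ B₁) (proj₁ (wf A∈R))) _ _
       (rule-rewrites A∈R (join A₁ B₁) (⊆-joinˡ A₁ B₁))
       (rule-rewrites B∈R (join A₁ B₁) (⊆-joinʳ A₁ B₁))

  locallyConfluent⇒condII : WellFormed → LocallyConfluent _⟶_ → CondII e R
  locallyConfluent⇒condII wf lc M N M,N∈R a a∈M =
    lc (M ∪ sing a) (⊆-nonempty {A = M} {B = M ∪ sing a} (X⊆X∪Y M (sing a)) (a , a∈M)) _ _
       rule-step nil-step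
    where
    Ma≡1 : lookup M a ≡ 1
    Ma≡1 = ≤-antisym (lhs-repetitionFree wf M,N∈R a) a∈M
    rule-step : (M ∪ sing a) ⟶ (N ∪ sing a)
    rule-step = subst ((M ∪ sing a) ⟶_) ([X∪Y]-X∪Z≡Z∪Y M (sing a) N)
                      (rule-rewrites M,N∈R (M ∪ sing a) (X⊆X∪Y M (sing a)))
    nil-step : (M ∪ sing a) ⟶ ((M - sing a) ∪ sing e)
    nil-step = subst ((M ∪ sing a) ⟶_) (cong (_∪ sing e) ([X∪Y]-[Y∪Y]≡X-Y M (sing a)))
                     (nil-rewrites a (M ∪ sing a) (pair⊆X∪sing {X = M} a Ma≡1))

  rule-rule-↓ : CondI e R → (A₁ , A₂) ∈ R → (B₁ , B₂) ∈ R → A₁ ⊆ M → B₁ ⊆ M →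
    ((M - A₁) ∪ A₂) ↓ ((M - B₁) ∪ B₂)
  rule-rule-↓ {A₁ = A₁} {A₂ = A₂} {B₁ = B₁} {B₂ = B₂} {M = M} condI A∈R B∈R A₁⊆M B₁⊆M
    with ×-≡-dec (vec-≡-dec _≟_) (vec-≡-dec _≟_) (A₁ , A₂) (B₁ , B₂)
  ... | yes refl = ↓-refl
  ... | no A≢B = ↓-in-context (join-lub {A = A₁} {M = M} {B = B₁} A₁⊆M B₁⊆M)
                   (⊆-joinˡ A₁ B₁) (⊆-joinʳ A₁ B₁) (condI A₁ A₂ B₁ B₂ A∈R B∈R A≢B)

  rule-nil-↓ : CondII e R → (A , B) ∈ R → RepetitionFree A → A ⊆ M → 2 ≤ lookup M a →
    ((M - A) ∪ B) ↓ ((M - pair a a) ∪ sing e)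
  rule-nil-↓ {A = A} {B = B} {M = M} {a = a} condII A,B∈R A-repetitionFree A⊆M 2≤Ma
    with lookup A a in Aa≡ | A-repetitionFree a
  ... | 0 | _ = independent-↓ (rule-rewrites A,B∈R) (nil-rewrites a)
                  (∪-⊆-at {C = A} {M = M} a A⊆M lookup-pair-≢
                    (subst₂ (λ x y → x + y ≤ lookup M a) (sym Aa≡) (sym (lookup-pair-≡ a)) 2≤Ma))
  ... | suc (suc _) | s≤s ()
  ... | 1 | _ = ↓-in-context A∪sing⊆M (X⊆X∪Y A (sing a)) (pair⊆X∪sing {X = A} a Aa≡)
                  (subst₂ _↓_ (sym ([X∪Y]-X∪Z≡Z∪Y A (sing a) B))
                              (sym (cong (_∪ sing e) ([X∪Y]-[Y∪Y]≡X-Y A (sing a))))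
                              (condII A B A,B∈R a (≤-reflexive (sym Aa≡))))
    where
    A∪sing⊆M : (A ∪ sing a) ⊆ M
    A∪sing⊆M = ∪-⊆-at {C = A} {M = M} a A⊆M lookup-sing-≢
                 (subst₂ (λ x y → x + y ≤ lookup M a) (sym Aa≡) (sym (lookup-sing-≡ a)) 2≤Ma)

  nil-nil-↓ : 2 ≤ lookup M a → 2 ≤ lookup M b →
    ((M - pair a a) ∪ sing e) ↓ ((M - pair b b) ∪ sing e)
  nil-nil-↓ {M = M} {a = a} {b = b} 2≤Ma 2≤Mb with a ≟ᶠ b
  ... | yes refl = ↓-refl
  ... | no a≢b = independent-↓ (nil-rewrites a) (nil-rewrites b)
                   (∪-⊆-at {C = pair a a} {M = M} b (2≤⇒pair⊆ {M = M} a 2≤Ma) lookup-pair-≢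
                     (subst₂ (λ x y → x + y ≤ lookup M b)
                       (sym (lookup-pair-≢ (a≢b ∘ sym))) (sym (lookup-pair-≡ b)) 2≤Mb))

  condI×condII⇒locallyConfluent : WellFormed → CondI e R → CondII e R → LocallyConfluent _⟶_
  condI×condII⇒locallyConfluent wf condI condII M _ _ _ = λ where
    (inj₁ (A₁ , A₂ , A∈R , A₁⊆M , refl)) (inj₁ (B₁ , B₂ , B∈R , B₁⊆M , refl)) →
      rule-rule-↓ condI A∈R B∈R A₁⊆M B₁⊆M
    (inj₁ (A , B , A,B∈R , A⊆M , refl)) (inj₂ (a , 2≤Ma , refl)) →
      rule-nil-↓ condII A,B∈R (lhs-repetitionFree wf A,B∈R) A⊆M 2≤Ma
    (inj₂ (a , 2≤Ma , refl)) (inj₁ (A , B , A,B∈R , A⊆M , refl)) →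
      ↓-sym (rule-nil-↓ condII A,B∈R (lhs-repetitionFree wf A,B∈R) A⊆M 2≤Ma)
    (inj₂ (a , 2≤Ma , refl)) (inj₂ (b , 2≤Mb , refl)) →
      nil-nil-↓ 2≤Ma 2≤Mb

lemma4p2 : ∀ {n : ℕ} (e : Fin n) (R : List (Rule n)) →
    (∀ {r} → r ∈ R → WellFormedRule r) →
    LocallyConfluent (Step e R) ⇔ (CondI e R × CondII e R)
lemma4p2 e R wf = mk⇔
  (λ lc → locallyConfluent⇒condI wf lc , locallyConfluent⇒condII wf lc)
  (λ (condI , condII) → condI×condII⇒locallyConfluent wf condI condII)
  where open LocalConfluence e R
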